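{- For every integer $k\geq 3$ there exists a connected graph $G$ and two distinct independent sets $I_s, I_t$ of $G$ of size $k$ such that there is no reconfiguration sequence from $I_s$ to $I_t$ under $(k,2)$-Token Jumping; that is, any reconfiguration sequence between them requires some token to move by distance at least $3$.
   Context: A configuration is a set of $k$ vertices (tokens on distinct vertices). A move under $(k,2)$-Token Jumping from configuration $D$ to $D'$ is a bijection $f: D\to D'$ with $\mathrm{dist}_G(v,f(v))\leq 2$ for all $v\in D$. A reconfiguration sequence is a sequence of configurations, each an independent set of size $k$, with a move between every two consecutive ones. -}

module Defs where

open import Level using (0ℓ)
open import Data.Nat using (ℕ; _≤_)
open import Data.Fin using (Fin)
open import Data.Fin.Subset using (Subset; _∈_; ∣_∣)
open import Data.Product using (Σ; ∃; _×_; _,_; proj₁)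
open import Data.Sum using (_⊎_)
open import Relation.Nullary using (¬_)
open import Relation.Binary.PropositionalEquality using (_≡_)
open import Relation.Binary.Construct.Closure.ReflexiveTransitive using (Star)
open import Function.Bundles using (_⤖_; Bijection)

record Graph : Set₁ where
  field
    n     : ℕ
    Adj   : Fin n → Fin n → Set
    sym   : ∀ {u v} → Adj u v → Adj v u
    irrefl : ∀ {u} → ¬ Adj u u

module _ (G : Graph) where
  open Graph G

  Vertex : Set
  Vertex = Fin n

  Connected : Set
  Connected = ∀ (u v : Vertex) → Star Adj u v

  DistAtMost2 : Vertex → Vertex → Set
  DistAtMost2 u v = u ≡ v ⊎ Adj u v ⊎ ∃ λ w → Adj u w × Adj w v

  IsIndependent : Subset n → Set
  IsIndependent D = ∀ u v → u ∈ D → v ∈ D → ¬ Adj u v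

  IndepSetOfSize : ℕ → Subset n → Set
  IndepSetOfSize k D = IsIndependent D × ∣ D ∣ ≡ k

  Elem : Subset n → Set
  Elem D = Σ Vertex (λ v → v ∈ D)

  Move : Subset n → Subset n → Set
  Move D D' = Σ (Elem D ⤖ Elem D') λ f →
                ∀ (x : Elem D) → DistAtMost2 (proj₁ x) (proj₁ (Bijection.to f x))

  Config : ℕ → Set
  Config k = Σ (Subset n) (IndepSetOfSize k)

  Step : (k : ℕ) → Config k → Config k → Set
  Step k (D , _) (D' , _) = Move D D'

  ReconfSeq : (k : ℕ) → Config k → Config k → Set
  ReconfSeq k = Star (Step k)

-- Take the double star with adjacent centres x and y, where x carries k − 1
-- pendant vertices and y the two leaves q₁ and q₂.  Every vertex within
-- distance 2 of q₁ or q₂ lies in the core {x, y, q₁, q₂}, so a move sends the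
-- tokens on q₁ and q₂ to two distinct core vertices.  An independent set of
-- size at least 3 meeting the core twice contains both leaves: y is adjacent
-- to the rest of the core, and x is adjacent to y and to every pendant, which
-- leaves only {x, q₁, q₂}.  So tokens stay on both leaves along any
-- reconfiguration sequence from I_s = {q₁, q₂} ∪ (k − 2 pendants), but
-- I_t = {q₁} ∪ (k − 1 pendants) has no token on q₂.
{-# OPTIONS --safe #-}
module Submission where

open import Defs
open import Data.Nat using (ℕ; suc; _+_; _≤_; s≤s; z≤n)
open import Data.Nat.Properties using (<⇒≱)
open import Data.Fin using (Fin; zero; suc)
open import Data.Fin.Subset using (Subset; _∈_; _∉_; _⊆_; ∣_∣; inside; outside; ⊥; ⊤)
open import Data.Fin.Subset.Properties using (_∈?_; p⊂q⇒∣p∣<∣q∣; ∣⊥∣≡0; ∣⊤∣≡n)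
open import Data.Vec using (_∷_; here; there)
open import Data.Vec.Properties.WithK using ([]=-irrelevant)
open import Data.Empty using (⊥-elim)
open import Data.Product using (Σ; ∃₂; _×_; _,_; proj₁; proj₂)
open import Data.Sum using (inj₁; inj₂)
open import Function using (_∘_; id)
open import Function.Bundles using (Bijection)
open import Relation.Nullary using (¬_; yes; no; contradiction)
open import Relation.Binary.PropositionalEquality using (_≡_; _≢_; refl; sym; cong; subst)
open import Relation.Binary.Construct.Closure.ReflexiveTransitive using (Star; ε; _◅_; _◅◅_; fold; reverse)

p⊆q∧∣q∣≤∣p∣⇒q⊆p : ∀ {n} {p q : Subset n} → p ⊆ q → ∣ q ∣ ≤ ∣ p ∣ → q ⊆ p
p⊆q∧∣q∣≤∣p∣⇒q⊆p {p = p} p⊆q ∣q∣≤∣p∣ {v} v∈q with v ∈? p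
... | yes v∈p = v∈p
... | no v∉p = contradiction ∣q∣≤∣p∣ (<⇒≱ (p⊂q⇒∣p∣<∣q∣ (p⊆q , v , v∈q , v∉p)))

module _ (G : Graph) where
  open Graph G using (n)

  Elem-≡ : ∀ {D} {a b : Elem G D} → proj₁ a ≡ proj₁ b → a ≡ b
  Elem-≡ {a = u , u∈D} {.u , u∈D′} refl = cong (u ,_) ([]=-irrelevant u∈D u∈D′)

  Move⇒distinct-targets : ∀ {D D′ u v} → Move G D D′ → u ∈ D → v ∈ D → u ≢ v →
    ∃₂ λ u′ v′ → u′ ∈ D′ × v′ ∈ D′ × u′ ≢ v′ × DistAtMost2 G u u′ × DistAtMost2 G v v′
  Move⇒distinct-targets (f , near) u∈D v∈D u≢v =
    proj₁ (to a) , proj₁ (to b) , proj₂ (to a) , proj₂ (to b) ,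
    (λ eq → u≢v (cong proj₁ (injective (Elem-≡ eq)))) , near a , near b
    where
    open Bijection f using (to; injective)
    a b : Elem G _
    a = _ , u∈D
    b = _ , v∈D

  ReconfSeq-invariant : ∀ {k} (P : Subset n → Set) →
    (∀ {D D′} → IndepSetOfSize G k D′ → Move G D D′ → P D → P D′) →
    ∀ {c c′} → ReconfSeq G k c c′ → P (proj₁ c) → P (proj₁ c′)
  ReconfSeq-invariant P preserved =
    fold (λ c c′ → P (proj₁ c) → P (proj₁ c′)) (λ {_} {c′} move rest → rest ∘ preserved (proj₂ c′) move) id

module DoubleStar (l : ℕ) where

  pattern x = zero
  pattern y = suc zero
  pattern q₁ = suc (suc zero)
  pattern q₂ = suc (suc (suc zero))
  pattern p i = suc (suc (suc (suc i)))

  data _~_ : Fin (4 + l) → Fin (4 + l) → Set where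
    x~y : x ~ y
    y~x : y ~ x
    x~p : ∀ i → x ~ p i
    p~x : ∀ i → p i ~ x
    y~q₁ : y ~ q₁
    q₁~y : q₁ ~ y
    y~q₂ : y ~ q₂
    q₂~y : q₂ ~ y

  ~-sym : ∀ {u v} → u ~ v → v ~ u
  ~-sym x~y = y~x
  ~-sym y~x = x~y
  ~-sym (x~p i) = p~x i
  ~-sym (p~x i) = x~p i
  ~-sym y~q₁ = q₁~y
  ~-sym q₁~y = y~q₁
  ~-sym y~q₂ = q₂~y
  ~-sym q₂~y = y~q₂

  ~-irrefl : ∀ {u} → ¬ u ~ u
  ~-irrefl ()

  G : Graph
  G = record { n = 4 + l ; Adj = _~_ ; sym = ~-sym ; irrefl = ~-irrefl }

  walk-to-x : ∀ u → Star _~_ u x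
  walk-to-x x = ε
  walk-to-x y = y~x ◅ ε
  walk-to-x q₁ = q₁~y ◅ y~x ◅ ε
  walk-to-x q₂ = q₂~y ◅ y~x ◅ ε
  walk-to-x (p i) = p~x i ◅ ε

  connected : Connected G
  connected u v = walk-to-x u ◅◅ reverse ~-sym (walk-to-x v)

  x∉∧y∉⇒independent : ∀ {D} → x ∉ D → y ∉ D → IsIndependent G D
  x∉∧y∉⇒independent x∉D _ _ _ u∈D _ x~y = x∉D u∈D
  x∉∧y∉⇒independent _ y∉D _ _ u∈D _ y~x = y∉D u∈D
  x∉∧y∉⇒independent x∉D _ _ _ u∈D _ (x~p i) = x∉D u∈D
  x∉∧y∉⇒independent x∉D _ _ _ _ v∈D (p~x i) = x∉D v∈D
  x∉∧y∉⇒independent _ y∉D _ _ u∈D _ y~q₁ = y∉D u∈D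
  x∉∧y∉⇒independent _ y∉D _ _ _ v∈D q₁~y = y∉D v∈D
  x∉∧y∉⇒independent _ y∉D _ _ u∈D _ y~q₂ = y∉D u∈D
  x∉∧y∉⇒independent _ y∉D _ _ _ v∈D q₂~y = y∉D v∈D

  data Core : Fin (4 + l) → Set where
    core-x : Core x
    core-y : Core y
    core-q₁ : Core q₁
    core-q₂ : Core q₂

  near-q₁⇒core : ∀ {v} → DistAtMost2 G q₁ v → Core v
  near-q₁⇒core (inj₁ refl) = core-q₁
  near-q₁⇒core (inj₂ (inj₁ q₁~y)) = core-y
  near-q₁⇒core (inj₂ (inj₂ (_ , q₁~y , y~x))) = core-x
  near-q₁⇒core (inj₂ (inj₂ (_ , q₁~y , y~q₁))) = core-q₁
  near-q₁⇒core (inj₂ (inj₂ (_ , q₁~y , y~q₂))) = core-q₂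

  near-q₂⇒core : ∀ {v} → DistAtMost2 G q₂ v → Core v
  near-q₂⇒core (inj₁ refl) = core-q₂
  near-q₂⇒core (inj₂ (inj₁ q₂~y)) = core-y
  near-q₂⇒core (inj₂ (inj₂ (_ , q₂~y , y~x))) = core-x
  near-q₂⇒core (inj₂ (inj₂ (_ , q₂~y , y~q₁))) = core-q₁
  near-q₂⇒core (inj₂ (inj₂ (_ , q₂~y , y~q₂))) = core-q₂

  y~core : ∀ {v} → Core v → v ≢ y → y ~ v
  y~core core-x _ = y~x
  y~core core-y y≢y = ⊥-elim (y≢y refl)
  y~core core-q₁ _ = y~q₁
  y~core core-q₂ _ = y~q₂

  x-q₁-q₂ : Subset (4 + l)
  x-q₁-q₂ = inside ∷ outside ∷ inside ∷ inside ∷ ⊥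

  independent∋x⇒⊆x-q₁-q₂ : ∀ {D} → IsIndependent G D → x ∈ D → D ⊆ x-q₁-q₂
  independent∋x⇒⊆x-q₁-q₂ _ _ {x} _ = here
  independent∋x⇒⊆x-q₁-q₂ ind x∈D {y} y∈D = ⊥-elim (ind _ _ x∈D y∈D x~y)
  independent∋x⇒⊆x-q₁-q₂ _ _ {q₁} _ = there (there here)
  independent∋x⇒⊆x-q₁-q₂ _ _ {q₂} _ = there (there (there here))
  independent∋x⇒⊆x-q₁-q₂ ind x∈D {p i} pi∈D = ⊥-elim (ind _ _ x∈D pi∈D (x~p i))

  Leaves : Subset (4 + l) → Set
  Leaves D = q₁ ∈ D × q₂ ∈ D

  independent∋x⇒leaves : ∀ {D} → IsIndependent G D → 3 ≤ ∣ D ∣ → x ∈ D → Leaves D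
  independent∋x⇒leaves {D} ind 3≤∣D∣ x∈D =
    x-q₁-q₂⊆D (there (there here)) , x-q₁-q₂⊆D (there (there (there here)))
    where
    ∣x-q₁-q₂∣≡3 : ∣ x-q₁-q₂ ∣ ≡ 3
    ∣x-q₁-q₂∣≡3 = cong (λ m → suc (suc (suc m))) (∣⊥∣≡0 l)
    x-q₁-q₂⊆D : x-q₁-q₂ ⊆ D
    x-q₁-q₂⊆D = p⊆q∧∣q∣≤∣p∣⇒q⊆p (independent∋x⇒⊆x-q₁-q₂ ind x∈D)
                                (subst (_≤ ∣ D ∣) (sym ∣x-q₁-q₂∣≡3) 3≤∣D∣)

  core-pair⇒leaves : ∀ {D u v} → IsIndependent G D → 3 ≤ ∣ D ∣ →
    Core u → Core v → u ≢ v → u ∈ D → v ∈ D → Leaves D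
  core-pair⇒leaves ind big core-x _ _ x∈D _ = independent∋x⇒leaves ind big x∈D
  core-pair⇒leaves ind big _ core-x _ _ x∈D = independent∋x⇒leaves ind big x∈D
  core-pair⇒leaves ind _ core-y cv y≢v y∈D v∈D = ⊥-elim (ind _ _ y∈D v∈D (y~core cv (y≢v ∘ sym)))
  core-pair⇒leaves ind _ cu core-y u≢y u∈D y∈D = ⊥-elim (ind _ _ y∈D u∈D (y~core cu u≢y))
  core-pair⇒leaves _ _ core-q₁ core-q₂ _ q₁∈D q₂∈D = q₁∈D , q₂∈D
  core-pair⇒leaves _ _ core-q₂ core-q₁ _ q₂∈D q₁∈D = q₁∈D , q₂∈D
  core-pair⇒leaves _ _ core-q₁ core-q₁ q₁≢q₁ _ _ = ⊥-elim (q₁≢q₁ refl)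
  core-pair⇒leaves _ _ core-q₂ core-q₂ q₂≢q₂ _ _ = ⊥-elim (q₂≢q₂ refl)

  leaves-preserved : ∀ {k D D′} → 3 ≤ k → IndepSetOfSize G k D′ → Move G D D′ → Leaves D → Leaves D′
  leaves-preserved 3≤k (ind , ∣D′∣≡k) move (q₁∈D , q₂∈D) =
    let u , v , u∈D′ , v∈D′ , u≢v , q₁→u , q₂→v = Move⇒distinct-targets G move q₁∈D q₂∈D (λ ())
    in core-pair⇒leaves ind (subst (3 ≤_) (sym ∣D′∣≡k) 3≤k)
         (near-q₁⇒core q₁→u) (near-q₂⇒core q₂→v) u≢v u∈D′ v∈D′

proposition3 : ∀ (k : ℕ) → 3 ≤ k →
    Σ Graph λ G → Connected G ×
      Σ (Subset (Graph.n G)) λ Is → Σ (Subset (Graph.n G)) λ It →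
        Σ (IndepSetOfSize G k Is) λ hs → Σ (IndepSetOfSize G k It) λ ht →
          Is ≢ It × ¬ ReconfSeq G k (Is , hs) (It , ht)
proposition3 k 3≤k@(s≤s (s≤s (s≤s (z≤n {n = m})))) =
  G , connected , Is , It , Is-indep , It-indep , (λ ()) ,
  λ seq → q₂∉It (proj₂ (ReconfSeq-invariant G Leaves (leaves-preserved 3≤k) seq Is-leaves))
  where
  open DoubleStar (suc (suc m))
  Is It : Subset (4 + suc (suc m))
  Is = outside ∷ outside ∷ inside ∷ inside ∷ outside ∷ ⊤
  It = outside ∷ outside ∷ inside ∷ outside ∷ ⊤
  Is-indep : IndepSetOfSize G k Is
  Is-indep = x∉∧y∉⇒independent (λ ()) (λ { (there ()) }) , cong (λ m → suc (suc m)) (∣⊤∣≡n (suc m))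
  It-indep : IndepSetOfSize G k It
  It-indep = x∉∧y∉⇒independent (λ ()) (λ { (there ()) }) , cong suc (∣⊤∣≡n (suc (suc m)))
  Is-leaves : Leaves Is
  Is-leaves = there (there here) , there (there (there here))
  q₂∉It : q₂ ∉ It
  q₂∉It (there (there (there ())))
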